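{- For $n\ge 3$, the Cartesian product $P_2\square P_n$ satisfies $\chi_{\mathrm{gp}}(P_2\square P_n)=2r$ if $n=3r$, $2r+1$ if $n=3r+1$, and $2r+2$ if $n=3r+2$.
   Context: $P_m$ is the path on $m$ vertices; $G\square H$ is the Cartesian product. A set is in general position if no shortest path contains more than two of its vertices; $\chi_{\mathrm{gp}}(G)$ is the minimum number of colours in a colouring of $V(G)$ with each colour class in general position. -}

module Defs where

open import Data.Nat using (ℕ; zero; suc; _+_; _*_; _≤_; _<_)
open import Data.Fin using (Fin; toℕ)
open import Data.Product using (_×_; _,_; Σ; ∃)
open import Data.Sum using (_⊎_)
open import Data.List using (List; []; _∷_)
open import Data.List.Membership.Propositional using (_∈_)
open import Relation.Binary.PropositionalEquality using (_≡_; _≢_)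
open import Relation.Nullary using (¬_)
open import Data.Empty using (⊥)

record Graph : Set₁ where
  field
    V   : Set
    Adj : V → V → Set
open Graph public

P : ℕ → Graph
P m = record { V = Fin m ; Adj = λ i j → (suc (toℕ i) ≡ toℕ j) ⊎ (suc (toℕ j) ≡ toℕ i) }

_□_ : Graph → Graph → Graph
G □ H = record
  { V   = V G × V H
  ; Adj = λ { (g , h) (g' , h') → (Adj G g g' × h ≡ h') ⊎ (g ≡ g' × Adj H h h') } }

data Walk (G : Graph) : V G → V G → Set where
  [_]    : (v : V G) → Walk G v v
  _∷⟨_⟩_ : (u : V G) {v w : V G} → Adj G u v → Walk G v w → Walk G u w

walkLength : {G : Graph} {u v : V G} → Walk G u v → ℕ
walkLength [ v ]          = 0
walkLength (u ∷⟨ e ⟩ p)   = suc (walkLength p)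

vertices : {G : Graph} {u v : V G} → Walk G u v → List (V G)
vertices [ v ]          = v ∷ []
vertices (u ∷⟨ e ⟩ p)   = u ∷ vertices p

IsShortest : {G : Graph} {u v : V G} → Walk G u v → Set
IsShortest {G} {u} {v} p = (q : Walk G u v) → walkLength p ≤ walkLength q

InGeneralPosition : (G : Graph) → (V G → Set) → Set
InGeneralPosition G S =
  {u v : V G} (p : Walk G u v) → IsShortest p →
  (x y z : V G) → S x → S y → S z →
  x ≢ y → y ≢ z → x ≢ z →
  x ∈ vertices p → y ∈ vertices p → z ∈ vertices p → ⊥

IsGPColouring : (G : Graph) (k : ℕ) → (V G → Fin k) → Set
IsGPColouring G k c = (i : Fin k) → InGeneralPosition G (λ x → c x ≡ i)

χgp≡ : Graph → ℕ → Set
χgp≡ G k = (Σ (V G → Fin k) (IsGPColouring G k))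
         × ((m : ℕ) → m < k → (c : V G → Fin m) → ¬ IsGPColouring G m c)

module Submission where

-- In P₂ □ Pₙ the graph distance is the ℓ¹ distance, and a set is in general position
-- exactly when none of its points lies between two others (d x y + d y z = d x z).
-- Among four vertices listed by non-increasing column, the second shares its row with
-- the first or the third, or else the third shares its row with the first; either way
-- that vertex lies between two of the others.  So every colour class has at most three
-- vertices and χ_gp ≥ ⌈2n/3⌉.  Conversely, cut the columns into blocks of three and split
-- each block by the parity of row + offset: the classes {(a,3q), (1-a,3q+1), (a,3q+2)}
-- have all pairwise distances 2, so they are in general position, giving 2⌈n/3⌉ colours.
-- For n = 3r+1 the last column alone, a pair at distance 1, takes one extra colour.

open import Algebra.Properties.CommutativeSemigroup using (interchange)
open import Data.Bool using (true; false)
open import Data.Empty using (⊥; ⊥-elim)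
open import Data.Fin using (Fin; zero; suc; toℕ; fromℕ<; inject₁)
open import Data.Fin.Properties using (_≟_; all?; toℕ-fromℕ<; toℕ-injective; toℕ-inject₁; toℕ<n)
open import Data.List using (List; []; _∷_; length; filter; map)
open import Data.List.Membership.Propositional using (_∈_)
open import Data.List.Properties using (length-map)
open import Data.List.Relation.Unary.All as All using (All; []; _∷_)
open import Data.List.Relation.Unary.All.Properties using (all-filter)
open import Data.List.Relation.Unary.AllPairs using (AllPairs; []; _∷_)
open import Data.List.Relation.Unary.AllPairs.Properties using (filter⁺)
open import Data.List.Relation.Unary.Any using (here; there)
open import Data.Nat using (ℕ; zero; suc; _+_; _*_; _∸_; _≤_; _<_; NonZero; z≤n; s≤s; s≤s⁻¹; ∣_-_∣; _/_; _%_; _<?_)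
open import Data.Nat.DivMod using (_mod_; m≡m%n+[m/n]*n; m%n<n; [m+kn]%n≡m%n; m<n⇒m%n≡m; m<n*o⇒m/o<n)
open import Data.Nat.Properties renaming (_≟_ to _≟ℕ_)
open import Data.Nat.Tactic.RingSolver using (solve-∀)
open import Data.Product using (Σ; ∃-syntax; _×_; _,_; proj₁; proj₂)
open import Data.Sum as Sum using (_⊎_; inj₁; inj₂; [_,_]′)
open import Function using (_∘_)
open import Relation.Binary.PropositionalEquality
open import Relation.Nullary using (¬_; yes; no; does; contradiction)
open import Relation.Nullary.Decidable using (from-yes; _×-dec_; _⊎-dec_; _→-dec_)

open import Defs

module _ {G : Graph} where

  _++ᵂ_ : ∀ {u v w} → Walk G u v → Walk G v w → Walk G u w
  [ _ ]        ++ᵂ q = q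
  (u ∷⟨ e ⟩ p) ++ᵂ q = u ∷⟨ e ⟩ (p ++ᵂ q)

  walkLength-++ᵂ : ∀ {u v w} (p : Walk G u v) (q : Walk G v w) →
                   walkLength (p ++ᵂ q) ≡ walkLength p + walkLength q
  walkLength-++ᵂ [ _ ]        q = refl
  walkLength-++ᵂ (u ∷⟨ e ⟩ p) q = cong suc (walkLength-++ᵂ p q)

  ∈-++ᵂ⁺ʳ : ∀ {u v w x} (p : Walk G u v) {q : Walk G v w} → x ∈ vertices q → x ∈ vertices (p ++ᵂ q)
  ∈-++ᵂ⁺ʳ [ _ ]        x∈q = x∈q
  ∈-++ᵂ⁺ʳ (u ∷⟨ e ⟩ p) x∈q = there (∈-++ᵂ⁺ʳ p x∈q)

  source∈vertices : ∀ {u v} (p : Walk G u v) → u ∈ vertices p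
  source∈vertices [ _ ]        = here refl
  source∈vertices (u ∷⟨ e ⟩ p) = here refl

  target∈vertices : ∀ {u v} (p : Walk G u v) → v ∈ vertices p
  target∈vertices [ _ ]        = here refl
  target∈vertices (u ∷⟨ e ⟩ p) = there (target∈vertices p)

  split : ∀ {u v w} (p : Walk G u v) → w ∈ vertices p →
          Σ (Walk G u w) λ p₁ → Σ (Walk G w v) λ p₂ → walkLength p₁ + walkLength p₂ ≡ walkLength p
  split [ v ]        (here refl) = [ v ] , [ v ] , refl
  split (u ∷⟨ e ⟩ p) (here refl) = [ u ] , u ∷⟨ e ⟩ p , refl
  split (u ∷⟨ e ⟩ p) (there w∈p) with split p w∈p
  ... | p₁ , p₂ , p₁+p₂≡p = u ∷⟨ e ⟩ p₁ , p₂ , cong suc p₁+p₂≡p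

module _ {G H : Graph} (f : V G → V H) (f-adj : ∀ {u v} → Adj G u v → Adj H (f u) (f v)) where

  mapWalk : ∀ {u v} → Walk G u v → Walk H (f u) (f v)
  mapWalk [ v ]        = [ f v ]
  mapWalk (u ∷⟨ e ⟩ p) = f u ∷⟨ f-adj e ⟩ mapWalk p

  walkLength-mapWalk : ∀ {u v} (p : Walk G u v) → walkLength (mapWalk p) ≡ walkLength p
  walkLength-mapWalk [ v ]        = refl
  walkLength-mapWalk (u ∷⟨ e ⟩ p) = cong suc (walkLength-mapWalk p)

record IsPathDistance (G : Graph) (d : V G → V G → ℕ) : Set where
  field
    ≤-walkLength : ∀ {u v} (p : Walk G u v) → d u v ≤ walkLength p
    geodesic     : ∀ u v → Σ (Walk G u v) λ p → walkLength p ≡ d u v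

edge-bounded⇒≤-walkLength : ∀ {G} (d : V G → V G → ℕ) →
  (∀ u → d u u ≡ 0) → (∀ u v w → d u w ≤ d u v + d v w) → (∀ {u v} → Adj G u v → d u v ≤ 1) →
  ∀ {u v} (p : Walk G u v) → d u v ≤ walkLength p
edge-bounded⇒≤-walkLength d d-refl triangle adj [ v ] = ≤-reflexive (d-refl v)
edge-bounded⇒≤-walkLength d d-refl triangle adj {u} {v} (_∷⟨_⟩_ u {w} e p) = begin
  d u v           ≤⟨ triangle u w v ⟩
  d u w + d w v   ≤⟨ +-mono-≤ (adj e) (edge-bounded⇒≤-walkLength d d-refl triangle adj p) ⟩
  suc (walkLength p) ∎
  where open ≤-Reasoning

Between : {A : Set} → (A → A → ℕ) → A → A → A → Set
Between d x y z = d x y + d y z ≡ d x z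

module PathDistance {G : Graph} {d : V G → V G → ℕ} (isPathDistance : IsPathDistance G d) where

  open IsPathDistance isPathDistance public

  d-refl : ∀ u → d u u ≡ 0
  d-refl u = n≤0⇒n≡0 (≤-walkLength [ u ])

  triangle : ∀ u v w → d u w ≤ d u v + d v w
  triangle u v w with geodesic u v | geodesic v w
  ... | p , p≡ | q , q≡ =
    subst (d u w ≤_) (trans (walkLength-++ᵂ p q) (cong₂ _+_ p≡ q≡)) (≤-walkLength (p ++ᵂ q))

  adj⇒d≤1 : ∀ {u v} → Adj G u v → d u v ≤ 1
  adj⇒d≤1 {u} {v} e = ≤-walkLength (u ∷⟨ e ⟩ [ v ])

  d≡0⇒≡ : ∀ {u v} → d u v ≡ 0 → u ≡ v
  d≡0⇒≡ {u} {v} d≡0 with geodesic u v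
  ... | [ _ ]         , _    = refl
  ... | (_ ∷⟨ _ ⟩ _) , len≡ = contradiction (trans len≡ d≡0) λ ()

  between-source : ∀ x z → Between d x x z
  between-source x z = cong (_+ d x z) (d-refl x)

  between-target : ∀ x z → Between d x z z
  between-target x z = trans (cong (d x z +_) (d-refl z)) (+-identityʳ _)

  IsGeodesic : ∀ {u v} → Walk G u v → Set
  IsGeodesic {u} {v} p = walkLength p ≡ d u v

  shortest⇒geodesic : ∀ {u v} (p : Walk G u v) → IsShortest p → IsGeodesic p
  shortest⇒geodesic {u} {v} p shortest with geodesic u v
  ... | q , q≡ = ≤-antisym (subst (walkLength p ≤_) q≡ (shortest q)) (≤-walkLength p)

  geodesic-tail : ∀ {u u' v} (e : Adj G u u') (p : Walk G u' v) → IsGeodesic (u ∷⟨ e ⟩ p) → IsGeodesic p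
  geodesic-tail {u} {u'} {v} e p geo = ≤-antisym (s≤s⁻¹ (begin
    suc (walkLength p) ≡⟨ geo ⟩
    d u v              ≤⟨ triangle u u' v ⟩
    d u u' + d u' v    ≤⟨ +-monoˡ-≤ (d u' v) (adj⇒d≤1 e) ⟩
    suc (d u' v)       ∎)) (≤-walkLength p)
    where open ≤-Reasoning

  geodesic⇒between : ∀ {u v w} (p : Walk G u v) → IsGeodesic p → w ∈ vertices p → Between d u w v
  geodesic⇒between {u} {v} {w} p geo w∈p with split p w∈p
  ... | p₁ , p₂ , p₁+p₂≡p = ≤-antisym (begin
    d u w + d w v                 ≤⟨ +-mono-≤ (≤-walkLength p₁) (≤-walkLength p₂) ⟩
    walkLength p₁ + walkLength p₂ ≡⟨ p₁+p₂≡p ⟩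
    walkLength p                  ≡⟨ geo ⟩
    d u v                         ∎) (triangle u w v)
    where open ≤-Reasoning

  geodesic-step : ∀ {u u' v w} (e : Adj G u u') (p : Walk G u' v) → IsGeodesic (u ∷⟨ e ⟩ p) →
                  w ∈ vertices p → d u w ≡ suc (d u' w)
  geodesic-step {u} {u'} {v} {w} e p geo w∈p = +-cancelʳ-≡ (d w v) _ _ (begin
    d u w + d w v         ≡⟨ geodesic⇒between (u ∷⟨ e ⟩ p) geo (there w∈p) ⟩
    d u v                 ≡⟨ geo ⟨
    suc (walkLength p)    ≡⟨ cong suc (geodesic-tail e p geo) ⟩
    suc (d u' v)          ≡⟨ cong suc (geodesic⇒between p (geodesic-tail e p geo) w∈p) ⟨
    suc (d u' w + d w v)  ∎)
    where open ≡-Reasoning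

  geodesic⇒ordered : ∀ {u v w₁ w₂} (p : Walk G u v) → IsGeodesic p → w₁ ∈ vertices p → w₂ ∈ vertices p →
                     Between d u w₁ w₂ ⊎ Between d u w₂ w₁
  geodesic⇒ordered [ _ ] _ (here refl) (here refl) = inj₁ (between-source _ _)
  geodesic⇒ordered (_ ∷⟨ _ ⟩ _) _ (here refl) _ = inj₁ (between-source _ _)
  geodesic⇒ordered (_ ∷⟨ _ ⟩ _) _ (there _) (here refl) = inj₂ (between-source _ _)
  geodesic⇒ordered {u} {w₁ = w₁} {w₂} (_∷⟨_⟩_ u {u'} e p) geo (there w₁∈p) (there w₂∈p) =
    Sum.map (shift w₁∈p w₂∈p) (shift w₂∈p w₁∈p) (geodesic⇒ordered p (geodesic-tail e p geo) w₁∈p w₂∈p)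
    where
    shift : ∀ {x y} → x ∈ vertices p → y ∈ vertices p → Between d u' x y → Between d u x y
    shift {x} {y} x∈p y∈p between = begin
      d u x + d x y        ≡⟨ cong (_+ d x y) (geodesic-step e p geo x∈p) ⟩
      suc (d u' x + d x y) ≡⟨ cong suc between ⟩
      suc (d u' y)         ≡⟨ geodesic-step e p geo y∈p ⟨
      d u y                ∎
      where open ≡-Reasoning

  NoBetween : (V G → Set) → Set
  NoBetween S = ∀ {x y z} → S x → S y → S z → x ≢ y → y ≢ z → x ≢ z → ¬ Between d x y z

  noBetween⇒inGeneralPosition : ∀ {S} → NoBetween S → InGeneralPosition G S
  noBetween⇒inGeneralPosition noBetween p shortest x y z Sx Sy Sz x≢y y≢z x≢z =
    go p (shortest⇒geodesic p shortest)
    where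
    -- Drop vertices until one of x, y, z is the first one; the geodesic orders the other two from it.
    go : ∀ {u v} (p : Walk G u v) → IsGeodesic p → x ∈ vertices p → y ∈ vertices p → z ∈ vertices p → ⊥
    go [ _ ] _ (here refl) (here refl) _ = x≢y refl
    go [ _ ] _ (here refl) (there ()) _
    go [ _ ] _ (there ()) _ _
    go p@(_ ∷⟨ _ ⟩ _) geo (here refl) y∈ z∈ =
      [ noBetween Sx Sy Sz x≢y y≢z x≢z
      , noBetween Sx Sz Sy x≢z (≢-sym y≢z) x≢y
      ]′ (geodesic⇒ordered p geo y∈ z∈)
    go p@(_ ∷⟨ _ ⟩ _) geo x∈@(there _) (here refl) z∈ =
      [ noBetween Sy Sx Sz (≢-sym x≢y) x≢z y≢z
      , noBetween Sy Sz Sx y≢z (≢-sym x≢z) (≢-sym x≢y)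
      ]′ (geodesic⇒ordered p geo x∈ z∈)
    go p@(_ ∷⟨ _ ⟩ _) geo x∈@(there _) y∈@(there _) (here refl) =
      [ noBetween Sz Sx Sy (≢-sym x≢z) x≢y (≢-sym y≢z)
      , noBetween Sz Sy Sx (≢-sym y≢z) (≢-sym x≢y) (≢-sym x≢z)
      ]′ (geodesic⇒ordered p geo x∈ y∈)
    go (_ ∷⟨ e ⟩ p) geo (there x∈) (there y∈) (there z∈) = go p (geodesic-tail e p geo) x∈ y∈ z∈

  inGeneralPosition⇒noBetween : ∀ {S} → InGeneralPosition G S → NoBetween S
  inGeneralPosition⇒noBetween gp {x} {y} {z} Sx Sy Sz x≢y y≢z x≢z between
    with geodesic x y | geodesic y z
  ... | p , p≡ | q , q≡ =
    gp (p ++ᵂ q) shortest x y z Sx Sy Sz x≢y y≢z x≢z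
       (source∈vertices (p ++ᵂ q)) (∈-++ᵂ⁺ʳ p (source∈vertices q)) (∈-++ᵂ⁺ʳ p (target∈vertices q))
    where
    shortest : IsShortest (p ++ᵂ q)
    shortest r = subst (_≤ walkLength r)
      (sym (trans (walkLength-++ᵂ p q) (trans (cong₂ _+_ p≡ q≡) between))) (≤-walkLength r)

  Equidistant : (V G → Set) → Set
  Equidistant S = ∃[ D ] ∀ {x y} → S x → S y → x ≢ y → d x y ≡ D

  equidistant⇒noBetween : ∀ {S} → Equidistant S → NoBetween S
  equidistant⇒noBetween (D , d≡D) {x} {y} {z} Sx Sy Sz x≢y y≢z x≢z between =
    x≢y (d≡0⇒≡ (trans (d≡D Sx Sy x≢y) D≡0))
    where
    D≡0 : D ≡ 0
    D≡0 = +-cancelˡ-≡ D D 0 (begin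
      D + D         ≡⟨ cong₂ _+_ (d≡D Sx Sy x≢y) (d≡D Sy Sz y≢z) ⟨
      d x y + d y z ≡⟨ between ⟩
      d x z         ≡⟨ d≡D Sx Sz x≢z ⟩
      D             ≡⟨ +-identityʳ D ⟨
      D + 0         ∎)
      where open ≡-Reasoning

  equidistantClasses⇒gpColouring : ∀ {k} (γ : V G → ℕ) (γ<k : ∀ x → γ x < k) →
    (∀ j → Equidistant (λ x → γ x ≡ j)) → IsGPColouring G k (λ x → fromℕ< (γ<k x))
  equidistantClasses⇒gpColouring γ γ<k equidistant i with equidistant (toℕ i)
  ... | D , d≡D =
    noBetween⇒inGeneralPosition (equidistant⇒noBetween (D , λ cx cy → d≡D (inClass cx) (inClass cy)))
    where
    inClass : ∀ {x} → fromℕ< (γ<k x) ≡ i → γ x ≡ toℕ i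
    inClass {x} cx = trans (sym (toℕ-fromℕ< (γ<k x))) (cong toℕ cx)

pathDistance : ∀ {m} → Fin m → Fin m → ℕ
pathDistance i j = ∣ toℕ i - toℕ j ∣

∣n-1+n∣≡1 : ∀ n → ∣ n - suc n ∣ ≡ 1
∣n-1+n∣≡1 n = trans (cong (∣ n -_∣) (+-comm 1 n)) (∣m-m+n∣≡n n 1)

P-adj⇒pathDistance≡1 : ∀ {m} {i j : Fin m} → Adj (P m) i j → pathDistance i j ≡ 1
P-adj⇒pathDistance≡1 {i = i} (inj₁ e) rewrite sym e = ∣n-1+n∣≡1 (toℕ i)
P-adj⇒pathDistance≡1 {j = j} (inj₂ e) rewrite sym e =
  trans (∣-∣-comm (suc (toℕ j)) (toℕ j)) (∣n-1+n∣≡1 (toℕ j))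

P-suc-adj : ∀ {m} {i j : Fin m} → Adj (P m) i j → Adj (P (suc m)) (suc i) (suc j)
P-suc-adj = Sum.map (cong suc) (cong suc)

P-inject₁-adj : ∀ {m} {i j : Fin m} → Adj (P m) i j → Adj (P (suc m)) (inject₁ i) (inject₁ j)
P-inject₁-adj {i = i} {j} =
  subst₂ (λ a b → (suc a ≡ b) ⊎ (suc b ≡ a)) (sym (toℕ-inject₁ i)) (sym (toℕ-inject₁ j))

pathGeodesic : ∀ {m} (i j : Fin m) → Σ (Walk (P m) i j) λ p → walkLength p ≡ pathDistance i j
pathGeodesic zero zero = [ zero ] , refl
pathGeodesic {suc (suc _)} zero (suc j) with pathGeodesic zero j
... | p , p≡ = zero ∷⟨ inj₁ refl ⟩ mapWalk suc P-suc-adj p ,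
               cong suc (trans (walkLength-mapWalk suc P-suc-adj p) p≡)
pathGeodesic {suc (suc _)} (suc i) zero with pathGeodesic i zero
... | p , p≡ = suc i ∷⟨ inj₂ (cong suc (toℕ-inject₁ i)) ⟩ mapWalk inject₁ P-inject₁-adj p ,
               cong suc (trans (walkLength-mapWalk inject₁ P-inject₁-adj p) (trans p≡ (∣-∣-identityʳ (toℕ i))))
pathGeodesic (suc i) (suc j) with pathGeodesic i j
... | p , p≡ = mapWalk suc P-suc-adj p , trans (walkLength-mapWalk suc P-suc-adj p) p≡

P-isPathDistance : ∀ {m} → IsPathDistance (P m) pathDistance
P-isPathDistance = record
  { ≤-walkLength = edge-bounded⇒≤-walkLength pathDistance (∣n-n∣≡0 ∘ toℕ)
                     (λ i j k → ∣-∣-triangle (toℕ i) (toℕ j) (toℕ k)) (≤-reflexive ∘ P-adj⇒pathDistance≡1)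
  ; geodesic     = pathGeodesic
  }

□-distance : {A B : Set} → (A → A → ℕ) → (B → B → ℕ) → A × B → A × B → ℕ
□-distance dG dH x y = dG (proj₁ x) (proj₁ y) + dH (proj₂ x) (proj₂ y)

+-interchange : ∀ a b c e → (a + b) + (c + e) ≡ (a + c) + (b + e)
+-interchange = interchange +-commutativeSemigroup

□-between : {A B : Set} {dG : A → A → ℕ} {dH : B → B → ℕ} {x y z : A × B} →
            Between dG (proj₁ x) (proj₁ y) (proj₁ z) → Between dH (proj₂ x) (proj₂ y) (proj₂ z) →
            Between (□-distance dG dH) x y z
□-between {dG = dG} {dH} {g , h} {g' , h'} {g'' , h''} betweenG betweenH =
  trans (+-interchange (dG g g') (dH h h') (dG g' g'') (dH h' h'')) (cong₂ _+_ betweenG betweenH)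

□-isPathDistance : ∀ {G H dG dH} → IsPathDistance G dG → IsPathDistance H dH →
                   IsPathDistance (G □ H) (□-distance dG dH)
□-isPathDistance {G} {H} {dG} {dH} isG isH = record
  { ≤-walkLength = edge-bounded⇒≤-walkLength (□-distance dG dH) d-refl triangle adj⇒d≤1
  ; geodesic     = geodesic
  }
  where
  module G′ = PathDistance isG
  module H′ = PathDistance isH

  d-refl : ∀ x → □-distance dG dH x x ≡ 0
  d-refl (g , h) = cong₂ _+_ (G′.d-refl g) (H′.d-refl h)

  triangle : ∀ x y z → □-distance dG dH x z ≤ □-distance dG dH x y + □-distance dG dH y z
  triangle (g , h) (g' , h') (g'' , h'') =
    ≤-trans (+-mono-≤ (G′.triangle g g' g'') (H′.triangle h h' h''))
            (≤-reflexive (+-interchange (dG g g') (dG g' g'') (dH h h') (dH h' h'')))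

  adj⇒d≤1 : ∀ {x y} → Adj (G □ H) x y → □-distance dG dH x y ≤ 1
  adj⇒d≤1 {g , h} (inj₁ (e , refl)) = +-mono-≤ (G′.adj⇒d≤1 e) (≤-reflexive (H′.d-refl h))
  adj⇒d≤1 {g , h} (inj₂ (refl , e)) = +-mono-≤ (≤-reflexive (G′.d-refl g)) (H′.adj⇒d≤1 e)

  geodesic : ∀ x y → Σ (Walk (G □ H) x y) λ p → walkLength p ≡ □-distance dG dH x y
  geodesic (g , h) (g' , h') with G′.geodesic g g' | H′.geodesic h h'
  ... | p , p≡ | q , q≡ = horizontal ++ᵂ vertical , (begin
      walkLength (horizontal ++ᵂ vertical)        ≡⟨ walkLength-++ᵂ horizontal vertical ⟩
      walkLength horizontal + walkLength vertical ≡⟨ cong₂ _+_ (walkLength-mapWalk _ _ p) (walkLength-mapWalk _ _ q) ⟩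
      walkLength p + walkLength q                 ≡⟨ cong₂ _+_ p≡ q≡ ⟩
      dG g g' + dH h h'                           ∎)
    where
    open ≡-Reasoning
    horizontal : Walk (G □ H) (g , h) (g' , h)
    horizontal = mapWalk (_, h) (λ e → inj₁ (e , refl)) p
    vertical : Walk (G □ H) (g' , h) (g' , h')
    vertical = mapWalk (g' ,_) (λ e → inj₂ (refl , e)) q

count : ∀ {m} → Fin m → List (Fin m) → ℕ
count i xs = length (filter (_≟ i) xs)

count-map : ∀ {A : Set} {m} (c : A → Fin m) i (xs : List A) →
            count i (map c xs) ≡ length (filter (λ x → c x ≟ i) xs)
count-map c i [] = refl
count-map c i (x ∷ xs) with does (c x ≟ i)
... | true  = cong suc (count-map c i xs)
... | false = count-map c i xs

count≤⇒length≤ : ∀ m k (xs : List (Fin m)) → (∀ i → count i xs ≤ k) → length xs ≤ m * k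
count≤⇒length≤ zero    k []  _        = z≤n
count≤⇒length≤ (suc m) k xs count≤k = begin
  length xs                            ≡⟨ length-split xs ⟩
  count zero xs + length (dropZero xs) ≤⟨ +-mono-≤ (count≤k zero) (count≤⇒length≤ m k (dropZero xs) λ i →
                                            subst (_≤ k) (sym (count-dropZero i xs)) (count≤k (suc i))) ⟩
  k + m * k                            ∎
  where
  open ≤-Reasoning

  dropZero : List (Fin (suc m)) → List (Fin m)
  dropZero []           = []
  dropZero (zero  ∷ xs) = dropZero xs
  dropZero (suc i ∷ xs) = i ∷ dropZero xs

  length-split : ∀ xs → length xs ≡ count zero xs + length (dropZero xs)
  length-split []           = refl
  length-split (zero  ∷ xs) = cong suc (length-split xs)
  length-split (suc i ∷ xs) = trans (cong suc (length-split xs)) (sym (+-suc _ _))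

  count-dropZero : ∀ i xs → count i (dropZero xs) ≡ count (suc i) xs
  count-dropZero i []           = refl
  count-dropZero i (zero  ∷ xs) = count-dropZero i xs
  count-dropZero i (suc j ∷ xs) with does (j ≟ i)
  ... | true  = cong suc (count-dropZero i xs)
  ... | false = count-dropZero i xs

Fin2-pigeonhole : (a b c : Fin 2) → b ≡ a ⊎ b ≡ c ⊎ c ≡ a
Fin2-pigeonhole zero       zero       _          = inj₁ refl
Fin2-pigeonhole (suc zero) (suc zero) _          = inj₁ refl
Fin2-pigeonhole zero       (suc zero) zero       = inj₂ (inj₂ refl)
Fin2-pigeonhole zero       (suc zero) (suc zero) = inj₂ (inj₁ refl)
Fin2-pigeonhole (suc zero) zero       zero       = inj₂ (inj₁ refl)
Fin2-pigeonhole (suc zero) zero       (suc zero) = inj₂ (inj₂ refl)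

Fin2-≢⇒∣-∣≡1 : {a b : Fin 2} → a ≢ b → ∣ toℕ a - toℕ b ∣ ≡ 1
Fin2-≢⇒∣-∣≡1 {zero}     {zero}     a≢b = contradiction refl a≢b
Fin2-≢⇒∣-∣≡1 {zero}     {suc zero} _   = refl
Fin2-≢⇒∣-∣≡1 {suc zero} {zero}     _   = refl
Fin2-≢⇒∣-∣≡1 {suc zero} {suc zero} a≢b = contradiction refl a≢b

∣-∣-between : ∀ {i j k} → k ≤ j → j ≤ i → ∣ i - j ∣ + ∣ j - k ∣ ≡ ∣ i - k ∣
∣-∣-between {i} {j} {k} k≤j j≤i
  rewrite m≤n⇒∣n-m∣≡n∸m j≤i | m≤n⇒∣n-m∣≡n∸m k≤j | m≤n⇒∣n-m∣≡n∸m (≤-trans k≤j j≤i) =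
  trans (sym (+-∸-assoc (i ∸ j) k≤j)) (cong (_∸ k) (m∸n+n≡m j≤i))

r+q*n-injective : ∀ n .{{_ : NonZero n}} {r r' q q'} → r < n → r' < n →
                  r + q * n ≡ r' + q' * n → r ≡ r' × q ≡ q'
r+q*n-injective n {r} {r'} {q} {q'} r<n r'<n eq =
  r≡r' , *-cancelʳ-≡ q q' n (+-cancelˡ-≡ r _ _ (trans eq (cong (_+ q' * n) (sym r≡r'))))
  where
  open ≡-Reasoning
  r≡r' : r ≡ r'
  r≡r' = begin
    r                 ≡⟨ m<n⇒m%n≡m r<n ⟨
    r % n             ≡⟨ [m+kn]%n≡m%n r q n ⟨
    (r + q * n) % n   ≡⟨ cong (_% n) eq ⟩
    (r' + q' * n) % n ≡⟨ [m+kn]%n≡m%n r' q' n ⟩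
    r' % n            ≡⟨ m<n⇒m%n≡m r'<n ⟩
    r'                ∎

r+q*n<k*n : ∀ {n r q k} → r < n → q < k → r + q * n < k * n
r+q*n<k*n {n} {r} {q} r<n q<k = ≤-trans (+-monoˡ-< (q * n) r<n) (*-monoˡ-≤ n q<k)

parity : Fin 2 → Fin 3 → ℕ
parity a o = (toℕ a + toℕ o) % 2

parity<2 : ∀ a o → parity a o < 2
parity<2 a o = m%n<n (toℕ a + toℕ o) 2

parity-collision : ∀ a o b o' → parity a o ≡ parity b o' →
                   (a ≡ b × o ≡ o') ⊎ ∣ toℕ a - toℕ b ∣ + ∣ toℕ o - toℕ o' ∣ ≡ 2
parity-collision = from-yes (all? λ a → all? λ o → all? λ b → all? λ o' →
  (parity a o ≟ℕ parity b o') →-dec (((a ≟ b) ×-dec (o ≟ o')) ⊎-dec (∣ toℕ a - toℕ b ∣ + ∣ toℕ o - toℕ o' ∣ ≟ℕ 2)))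

module Ladder (n : ℕ) where

  Vertex : Set
  Vertex = Fin 2 × Fin n

  column : Vertex → ℕ
  column x = toℕ (proj₂ x)

  dist : Vertex → Vertex → ℕ
  dist = □-distance pathDistance pathDistance

  open PathDistance (□-isPathDistance (P-isPathDistance {2}) (P-isPathDistance {n}))

  GPColouring : ℕ → Set
  GPColouring k = Σ (Vertex → Fin k) (IsGPColouring (P 2 □ P n) k)

  between-sorted : ∀ {x y z} → column z ≤ column y → column y ≤ column x →
                   proj₁ y ≡ proj₁ x ⊎ proj₁ y ≡ proj₁ z → Between dist x y z
  between-sorted {x} {y} {z} k≤j j≤i sameRow =
    □-between {dG = pathDistance} {dH = pathDistance} {x} {y} {z} (rowBetween sameRow) (∣-∣-between k≤j j≤i)
    where
    module Row = PathDistance (P-isPathDistance {2})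
    rowBetween : ∀ {a b c} → b ≡ a ⊎ b ≡ c → Between pathDistance a b c
    rowBetween {a} {c = c} (inj₁ refl) = Row.between-source a c
    rowBetween {a} {c = c} (inj₂ refl) = Row.between-target a c

  Precedes : Vertex → Vertex → Set
  Precedes x y = column y ≤ column x × x ≢ y

  sortedTriple-zigzag : ∀ {S} → NoBetween S → ∀ {x y z} → S x → S y → S z →
                        Precedes x y → Precedes y z → Precedes x z → ¬ (proj₁ y ≡ proj₁ x ⊎ proj₁ y ≡ proj₁ z)
  sortedTriple-zigzag noBetween Sx Sy Sz (j≤i , x≢y) (k≤j , y≢z) (_ , x≢z) sameRow =
    noBetween Sx Sy Sz x≢y y≢z x≢z (between-sorted k≤j j≤i sameRow)

  sorted-length≤3 : ∀ {S} → NoBetween S → ∀ {F} → AllPairs Precedes F → All S F → length F ≤ 3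
  sorted-length≤3 _ {[]}                _ _ = z≤n
  sorted-length≤3 _ {_ ∷ []}            _ _ = s≤s z≤n
  sorted-length≤3 _ {_ ∷ _ ∷ []}        _ _ = s≤s (s≤s z≤n)
  sorted-length≤3 _ {_ ∷ _ ∷ _ ∷ []}    _ _ = s≤s (s≤s (s≤s z≤n))
  sorted-length≤3 noBetween {x₁ ∷ x₂ ∷ x₃ ∷ _ ∷ _}
    ((p₁₂ ∷ p₁₃ ∷ p₁₄ ∷ _) ∷ (p₂₃ ∷ _) ∷ (p₃₄ ∷ _) ∷ _) (s₁ ∷ s₂ ∷ s₃ ∷ s₄ ∷ _)
    with Fin2-pigeonhole (proj₁ x₁) (proj₁ x₂) (proj₁ x₃)
  ... | inj₁ r₂≡r₁        = ⊥-elim (sortedTriple-zigzag noBetween s₁ s₂ s₃ p₁₂ p₂₃ p₁₃ (inj₁ r₂≡r₁))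
  ... | inj₂ (inj₁ r₂≡r₃) = ⊥-elim (sortedTriple-zigzag noBetween s₁ s₂ s₃ p₁₂ p₂₃ p₁₃ (inj₂ r₂≡r₃))
  ... | inj₂ (inj₂ r₃≡r₁) = ⊥-elim (sortedTriple-zigzag noBetween s₁ s₃ s₄ p₁₃ p₃₄ p₁₄ (inj₁ r₃≡r₁))

  columnsBelow : (k : ℕ) → k ≤ n → List Vertex
  columnsBelow zero    _   = []
  columnsBelow (suc k) k<n = (zero , fromℕ< k<n) ∷ (suc zero , fromℕ< k<n) ∷ columnsBelow k (<⇒≤ k<n)

  length-columnsBelow : ∀ k k≤n → length (columnsBelow k k≤n) ≡ k * 2
  length-columnsBelow zero    _   = refl
  length-columnsBelow (suc k) k<n = cong (2 +_) (length-columnsBelow k (<⇒≤ k<n))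

  columnsBelow-< : ∀ k k≤n → All (λ x → column x < k) (columnsBelow k k≤n)
  columnsBelow-< zero    _   = []
  columnsBelow-< (suc k) k<n =
    top<1+k ∷ top<1+k ∷ All.map m<n⇒m<1+n (columnsBelow-< k (<⇒≤ k<n))
    where
    top<1+k : toℕ (fromℕ< k<n) < suc k
    top<1+k = ≤-reflexive (cong suc (toℕ-fromℕ< k<n))

  columnsBelow-sorted : ∀ k k≤n → AllPairs Precedes (columnsBelow k k≤n)
  columnsBelow-sorted zero    _   = []
  columnsBelow-sorted (suc k) k<n =
    ((≤-refl , λ ()) ∷ All.map below lower) ∷ All.map below lower ∷ columnsBelow-sorted k (<⇒≤ k<n)
    where
    lower : All (λ x → column x < k) (columnsBelow k (<⇒≤ k<n))
    lower = columnsBelow-< k (<⇒≤ k<n)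
    below : ∀ {a y} → column y < k → Precedes (a , fromℕ< k<n) y
    below {y = y} y<k =
      subst (column y ≤_) (sym (toℕ-fromℕ< k<n)) (<⇒≤ y<k) ,
      λ x≡y → <-irrefl (trans (cong column (sym x≡y)) (toℕ-fromℕ< k<n)) y<k

  gpColouring⇒n*2≤m*3 : ∀ {m} (c : Vertex → Fin m) → IsGPColouring (P 2 □ P n) m c → n * 2 ≤ m * 3
  gpColouring⇒n*2≤m*3 {m} c gp = begin
    n * 2                      ≡⟨ length-columnsBelow n ≤-refl ⟨
    length allVertices         ≡⟨ length-map c allVertices ⟨
    length (map c allVertices) ≤⟨ count≤⇒length≤ m 3 (map c allVertices) classSize≤3 ⟩
    m * 3                      ∎
    where
    open ≤-Reasoning
    allVertices : List Vertex
    allVertices = columnsBelow n ≤-refl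
    classSize≤3 : ∀ i → count i (map c allVertices) ≤ 3
    classSize≤3 i = subst (_≤ 3) (sym (count-map c i allVertices))
      (sorted-length≤3 (inGeneralPosition⇒noBetween (gp i))
        (filter⁺ (λ x → c x ≟ i) (columnsBelow-sorted n ≤-refl)) (all-filter (λ x → c x ≟ i) allVertices))

  χgp-lowerBound : ∀ {k} → k * 3 ≤ n * 2 + 2 → ∀ m → m < k → (c : Vertex → Fin m) →
                   ¬ IsGPColouring (P 2 □ P n) m c
  χgp-lowerBound {k} k*3≤ m m<k c gp = 3≰2 (+-cancelʳ-≤ (m * 3) 3 2 (begin
    3 + m * 3  ≤⟨ *-monoˡ-≤ 3 m<k ⟩
    k * 3      ≤⟨ k*3≤ ⟩
    n * 2 + 2  ≤⟨ +-monoˡ-≤ 2 (gpColouring⇒n*2≤m*3 c gp) ⟩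
    m * 3 + 2  ≡⟨ +-comm (m * 3) 2 ⟩
    2 + m * 3  ∎))
    where
    open ≤-Reasoning
    3≰2 : ¬ 3 ≤ 2
    3≰2 (s≤s (s≤s ()))

  gpColouring⇒χgp≡ : ∀ {k} → k * 3 ≤ n * 2 + 2 → GPColouring k → χgp≡ (P 2 □ P n) k
  gpColouring⇒χgp≡ k*3≤ colouring = colouring , χgp-lowerBound k*3≤

  block : Fin n → ℕ
  block i = toℕ i / 3

  offset : Fin n → Fin 3
  offset i = toℕ i mod 3

  column≡ : ∀ i → toℕ i ≡ block i * 3 + toℕ (offset i)
  column≡ i = trans (m≡m%n+[m/n]*n (toℕ i) 3)
    (trans (+-comm (toℕ i % 3) (block i * 3)) (cong (block i * 3 +_) (sym (toℕ-fromℕ< (m%n<n (toℕ i) 3)))))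

  sameBlock-distance : ∀ i j → block i ≡ block j → ∣ toℕ i - toℕ j ∣ ≡ ∣ toℕ (offset i) - toℕ (offset j) ∣
  sameBlock-distance i j sameBlock = begin
    ∣ toℕ i - toℕ j ∣                                               ≡⟨ cong₂ ∣_-_∣ (column≡ i) (column≡ j) ⟩
    ∣ block i * 3 + toℕ (offset i) - block j * 3 + toℕ (offset j) ∣
      ≡⟨ cong (λ q → ∣ block i * 3 + toℕ (offset i) - q * 3 + toℕ (offset j) ∣) sameBlock ⟨
    ∣ block i * 3 + toℕ (offset i) - block i * 3 + toℕ (offset j) ∣ ≡⟨ ∣m+n-m+o∣≡∣n-o∣ (block i * 3) _ _ ⟩
    ∣ toℕ (offset i) - toℕ (offset j) ∣                             ∎
    where open ≡-Reasoning

  zigzag : Vertex → ℕ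
  zigzag (a , i) = parity a (offset i) + block i * 2

  zigzag-< : ∀ K x → column x < 3 * K → zigzag x < 2 * K
  zigzag-< K (a , i) i<3K = subst (zigzag (a , i) <_) (*-comm K 2)
    (r+q*n<k*n {k = K} (parity<2 a (offset i)) (m<n*o⇒m/o<n (subst (toℕ i <_) (*-comm 3 K) i<3K)))

  zigzag-distance : ∀ {x y} → zigzag x ≡ zigzag y → x ≢ y → dist x y ≡ 2
  zigzag-distance {a , i} {b , j} eq x≢y
    with r+q*n-injective 2 (parity<2 a (offset i)) (parity<2 b (offset j)) eq
  ... | sameParity , sameBlock with parity-collision a (offset i) b (offset j) sameParity
  ... | inj₁ (refl , sameOffset) = contradiction (cong (a ,_) (toℕ-injective (begin
    toℕ i                        ≡⟨ column≡ i ⟩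
    block i * 3 + toℕ (offset i) ≡⟨ cong₂ (λ q o → q * 3 + toℕ o) sameBlock sameOffset ⟩
    block j * 3 + toℕ (offset j) ≡⟨ column≡ j ⟨
    toℕ j                        ∎))) x≢y
    where open ≡-Reasoning
  ... | inj₂ offsetDistance≡2 =
    trans (cong (∣ toℕ a - toℕ b ∣ +_) (sameBlock-distance i j sameBlock)) offsetDistance≡2

  zigzag-equidistant : ∀ j → Equidistant (λ x → zigzag x ≡ j)
  zigzag-equidistant j = 2 , λ zx zy → zigzag-distance (trans zx (sym zy))

  zigzagColouring : ∀ K → n ≤ 3 * K → GPColouring (2 * K)
  zigzagColouring K n≤3K = _ , equidistantClasses⇒gpColouring zigzag zigzag<2K zigzag-equidistant
    where
    zigzag<2K : ∀ x → zigzag x < 2 * K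
    zigzag<2K (a , i) = zigzag-< K (a , i) (<-≤-trans (toℕ<n i) n≤3K)

  sameColumn-distance : ∀ {x y} → column x ≡ column y → x ≢ y → dist x y ≡ 1
  sameColumn-distance {a , i} {b , j} i≡j x≢y with toℕ-injective i≡j
  ... | refl = trans (cong (∣ toℕ a - toℕ b ∣ +_) (∣n-n∣≡0 (toℕ i)))
                     (trans (+-identityʳ _) (Fin2-≢⇒∣-∣≡1 (x≢y ∘ cong (_, i))))

  module LastColumnApart (r : ℕ) (n≡3r+1 : n ≡ 3 * r + 1) where

    colour : Vertex → ℕ
    colour (a , i) with toℕ i <? 3 * r
    ... | yes _ = zigzag (a , i)
    ... | no  _ = 2 * r

    colour-cases : ∀ x → (column x < 3 * r × colour x ≡ zigzag x) ⊎ (column x ≡ 3 * r × colour x ≡ 2 * r)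
    colour-cases (a , i) with toℕ i <? 3 * r
    ... | yes i<3r = inj₁ (i<3r , refl)
    ... | no  i≮3r = inj₂ (≤-antisym i≤3r (≮⇒≥ i≮3r) , refl)
      where
      i≤3r : toℕ i ≤ 3 * r
      i≤3r = s≤s⁻¹ (subst (toℕ i <_) (trans n≡3r+1 (+-comm (3 * r) 1)) (toℕ<n i))

    colour< : ∀ x → colour x < 2 * r + 1
    colour< x with colour-cases x
    ... | inj₁ (i<3r , c≡z) = subst (_< 2 * r + 1) (sym c≡z) (<-≤-trans (zigzag-< r x i<3r) (m≤m+n (2 * r) 1))
    ... | inj₂ (_ , c≡2r)   = subst (_< 2 * r + 1) (sym c≡2r) (m<m+n (2 * r) (s≤s z≤n))

    colour-equidistant : ∀ j → Equidistant (λ x → colour x ≡ j)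
    colour-equidistant j with j <? 2 * r
    ... | yes j<2r = 2 , λ cx cy → zigzag-distance (trans (onZigzag cx) (sym (onZigzag cy)))
      where
      onZigzag : ∀ {x} → colour x ≡ j → zigzag x ≡ j
      onZigzag {x} cx with colour-cases x
      ... | inj₁ (_ , c≡z)  = trans (sym c≡z) cx
      ... | inj₂ (_ , c≡2r) = contradiction (trans (sym cx) c≡2r) (<⇒≢ j<2r)
    ... | no j≮2r = 1 , λ cx cy x≢y → sameColumn-distance (trans (onLastColumn cx) (sym (onLastColumn cy))) x≢y
      where
      onLastColumn : ∀ {x} → colour x ≡ j → column x ≡ 3 * r
      onLastColumn {x} cx with colour-cases x
      ... | inj₁ (i<3r , c≡z) = contradiction (subst (_< 2 * r) (trans (sym c≡z) cx) (zigzag-< r x i<3r)) j≮2r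
      ... | inj₂ (i≡3r , _)   = i≡3r

    gpColouring : GPColouring (2 * r + 1)
    gpColouring = _ , equidistantClasses⇒gpColouring colour colour< colour-equidistant

mainTheorem15 : (n : ℕ) → 3 ≤ n → (r : ℕ) →
    (n ≡ 3 * r → χgp≡ (P 2 □ P n) (2 * r))
    × (n ≡ 3 * r + 1 → χgp≡ (P 2 □ P n) (2 * r + 1))
    × (n ≡ 3 * r + 2 → χgp≡ (P 2 □ P n) (2 * r + 2))
mainTheorem15 _ _ r = (λ { refl → χgp[3r] }) , (λ { refl → χgp[3r+1] }) , (λ { refl → χgp[3r+2] })
  where
  slack : ∀ {a b} t → a + t ≡ b → a ≤ b
  slack t eq = ≤-trans (m≤m+n _ t) (≤-reflexive eq)

  ceiling[3r] : ∀ r → (2 * r) * 3 + 2 ≡ (3 * r) * 2 + 2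
  ceiling[3r] = solve-∀
  ceiling[3r+1] : ∀ r → (2 * r + 1) * 3 + 1 ≡ (3 * r + 1) * 2 + 2
  ceiling[3r+1] = solve-∀
  ceiling[3r+2] : ∀ r → (2 * r + 2) * 3 + 0 ≡ (3 * r + 2) * 2 + 2
  ceiling[3r+2] = solve-∀
  blocks[3r+2] : ∀ r → (3 * r + 2) + 1 ≡ 3 * suc r
  blocks[3r+2] = solve-∀
  colours[3r+2] : ∀ r → 2 * suc r ≡ 2 * r + 2
  colours[3r+2] = solve-∀

  χgp[3r] : χgp≡ (P 2 □ P (3 * r)) (2 * r)
  χgp[3r] = Ladder.gpColouring⇒χgp≡ (3 * r) (slack 2 (ceiling[3r] r)) (Ladder.zigzagColouring (3 * r) r ≤-refl)

  χgp[3r+1] : χgp≡ (P 2 □ P (3 * r + 1)) (2 * r + 1)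
  χgp[3r+1] = Ladder.gpColouring⇒χgp≡ (3 * r + 1) (slack 1 (ceiling[3r+1] r))
                (Ladder.LastColumnApart.gpColouring (3 * r + 1) r refl)

  χgp[3r+2] : χgp≡ (P 2 □ P (3 * r + 2)) (2 * r + 2)
  χgp[3r+2] = Ladder.gpColouring⇒χgp≡ (3 * r + 2) (slack 0 (ceiling[3r+2] r))
                (subst (Ladder.GPColouring (3 * r + 2)) (colours[3r+2] r)
                  (Ladder.zigzagColouring (3 * r + 2) (suc r) (slack 1 (blocks[3r+2] r))))
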